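{- Let $\varphi$ be a 3-CNF formula over variables $x_1,\dots,x_n$, and let $\mathsf{TA}_\varphi$ be its threshold automaton. If $\sigma_0$ is an initial configuration of $\mathsf{TA}_\varphi$ and $\tau$ is a finite schedule applicable to $\sigma_0$, then for every $i\in\{1,\dots,n\}$: if some configuration $\sigma$ on the path $\mathrm{path}(\sigma_0,\tau)$ satisfies $\sigma.\kappa(\top_i)\ge1$, then every configuration $\sigma'$ on that path satisfies $\sigma'.\kappa(\bot_i)=0$; and if some configuration $\sigma$ on the path satisfies $\sigma.\kappa(\bot_i)\ge1$, then every configuration $\sigma'$ on the path satisfies $\sigma'.\kappa(\top_i)=0$.
   Context: A threshold automaton $\mathsf{TA}=(\mathcal L,\mathcal I,\Gamma,\mathcal R)$ over environment $(\Pi,RC,N)$ has locations $\mathcal L$, initial locations $\mathcal I$, shared variables $\Gamma$ over $\mathbb N_0$, and rules $r=(r.\mathit{from},r.\mathit{to},r.\varphi,r.\vec u)$ with $r.\varphi$ a conjunction of guards and $r.\vec u\in\{0,1\}^\Gamma$ (written as a list of increments $x{+}{+}$). A configuration $\sigma=(\sigma.\kappa,\sigma.\vec g,\sigma.\vec p)$ has $\sigma.\kappa\colon\mathcal L\to\mathbb N_0$, $\sigma.\vec g\in\mathbb N_0^\Gamma$, $\sigma.\vec p\in RC$ with $\sum_\ell\sigma.\kappa(\ell)=N(\sigma.\vec p)$; initial if $\sigma.\kappa$ vanishes outside $\mathcal I$ and $\sigma.\vec g=\vec0$. $\sigma$ enables $r$ if $\sigma.\kappa(r.\mathit{from})>0$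 and $(\sigma.\vec g,\sigma.\vec p)$ satisfies $r.\varphi$; $r(\sigma)$ keeps parameters, has shared values $\sigma.\vec g+r.\vec u$, moves one process from $r.\mathit{from}$ to $r.\mathit{to}$. A schedule $r_1\dots r_m$ applicable to $\sigma_0$ yields the path $\sigma_0,r_1,\sigma_1,\dots,r_m,\sigma_m$ with $r_i$ enabled in $\sigma_{i-1}$ and $\sigma_i=r_i(\sigma_{i-1})$. For a 3-CNF formula $\varphi=C_1\wedge\dots\wedge C_m$ over $x_1,\dots,x_n$, $\mathsf{TA}_\varphi$ is defined as follows. Environment: a single parameter $k$, $RC=\mathit{true}$, $N(k)=k$. Locations: $\ell_1,\dots,\ell_n,\top_1,\dots,\top_n,\bot_1,\dots,\bot_n,\ell_{mid},\ell_F$; initial locations $\ell_1,\dots,\ell_n$. Shared variables: $y_1,\dots,y_n,\bar y_1,\dots,\bar y_n,c_1,\dots,c_m$. Rules: for each $i$, $(\ell_i,\top_i,\ \bar y_i<1,\ y_i{+}{+})$ and $(\ell_i,\bot_i,\ y_i<1,\ \bar y_i{+}{+})$; for each $i$, $(\top_i,\ell_{mid},\mathit{true},\ c_{j_1}{+}{+},\dots,c_{j_s}{+}{+})$ where $C_{j_1},\dots,C_{j_s}$ are the clauses containing the literal $x_i$, and $(\bot_i,\ell_{mid},\mathit{true},\ c_{j_1}{+}{+},\dots,c_{j_s}{+}{+})$ where $C_{j_1},\dots,C_{j_s}$ are the clauses containing $\neg x_i$; and $(\ell_{mid},\ell_F,\ c_1\ge1\wedge\dots\wedge c_m\ge1,\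 \vec0)$. -}

module Defs where

open import Data.Nat using (ℕ; zero; suc; _+_; _∸_; _<_; _≥_; _>_)
open import Data.Fin using (Fin)
open import Data.Fin.Properties using () renaming (_≟_ to _≟ᶠ_)
open import Data.Vec using (Vec; lookup; toList)
open import Data.List using (List; []; _∷_; map; _++_)
open import Data.Nat.ListAction using (sum)
open import Data.Bool.ListAction using (any)
open import Data.Empty using (⊥)
open import Data.List using () renaming (allFin to allFinL)
open import Data.Bool using (Bool; true; false; if_then_else_)
open import Data.Unit using (⊤)
open import Data.Product using (_×_)
open import Relation.Nullary using (does)
open import Relation.Binary.PropositionalEquality using (_≡_)

-- Generic threshold automata over the environment with a single
-- parameter k, RC = true, N(k) = k.  Parameter valuations are ℕ.

record ThresholdAutomaton : Set₁ where
  field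
    Loc     : Set
    allLoc  : List Loc
    Initial : Loc → Set
    Shared  : Set
    Rule    : Set
    from to : Rule → Loc
    guard   : Rule → (Shared → ℕ) → ℕ → Set
    upd     : Rule → Shared → ℕ
    locEq   : Loc → Loc → Bool

module _ (TA : ThresholdAutomaton) where
  open ThresholdAutomaton TA

  record Config : Set where
    constructor cfg
    field
      κ : Loc → ℕ
      g : Shared → ℕ
      p : ℕ

  open Config public

  IsConfig : Config → Set
  IsConfig σ = sum (map (κ σ) allLoc) ≡ p σ

  IsInitial : Config → Set
  IsInitial σ = IsConfig σ × ((ℓ : Loc) → (Initial ℓ → ⊥) → κ σ ℓ ≡ 0)
                          × ((x : Shared) → g σ x ≡ 0)

  Enabled : Rule → Config → Set
  Enabled r σ = κ σ (from r) > 0 × guard r (g σ) (p σ)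

  [_] : Bool → ℕ
  [ true ]  = 1
  [ false ] = 0

  apply : Rule → Config → Config
  apply r σ = cfg (λ ℓ → (κ σ ℓ ∸ [ locEq ℓ (from r) ]) + [ locEq ℓ (to r) ])
                  (λ x → g σ x + upd r x)
                  (p σ)

  data Applicable : Config → List Rule → Set where
    []  : ∀ {σ} → Applicable σ []
    _∷_ : ∀ {σ r τ} → Enabled r σ → Applicable (apply r σ) τ → Applicable σ (r ∷ τ)

  data OnPath : Config → List Rule → Config → Set where
    here  : ∀ {σ τ} → OnPath σ τ σ
    there : ∀ {σ r τ σ'} → OnPath (apply r σ) τ σ' → OnPath σ (r ∷ τ) σ'

data Literal (n : ℕ) : Set where
  pos neg : Fin n → Literal n

Clause : ℕ → Set
Clause n = Vec (Literal n) 3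

CNF3 : ℕ → ℕ → Set
CNF3 n m = Vec (Clause n) m

litEq : ∀ {n} → Literal n → Literal n → Bool
litEq (pos i) (pos j) = does (i ≟ᶠ j)
litEq (neg i) (neg j) = does (i ≟ᶠ j)
litEq _ _ = false

occurs : ∀ {n} → Literal n → Clause n → Bool
occurs l C = any (litEq l) (toList C)

data Loc (n : ℕ) : Set where
  ℓ   : Fin n → Loc n
  top : Fin n → Loc n
  bot : Fin n → Loc n
  mid : Loc n
  fin : Loc n

data Shared (n m : ℕ) : Set where
  y    : Fin n → Shared n m
  ybar : Fin n → Shared n m
  c    : Fin m → Shared n m

data Rule (n : ℕ) : Set where
  chooseTrue  : Fin n → Rule n
  chooseFalse : Fin n → Rule n
  topMid      : Fin n → Rule n
  botMid      : Fin n → Rule n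
  midFin      : Rule n

locEqTA : ∀ {n} → Loc n → Loc n → Bool
locEqTA (ℓ i)   (ℓ j)   = does (i ≟ᶠ j)
locEqTA (top i) (top j) = does (i ≟ᶠ j)
locEqTA (bot i) (bot j) = does (i ≟ᶠ j)
locEqTA mid mid = true
locEqTA fin fin = true
locEqTA _ _ = false

allLocTA : (n : ℕ) → List (Loc n)
allLocTA n = map ℓ (allFinL n) ++ map top (allFinL n) ++ map bot (allFinL n)
             ++ (mid ∷ fin ∷ [])

data InitialTA {n : ℕ} : Loc n → Set where
  init : (i : Fin n) → InitialTA (ℓ i)

fromTA toTA : ∀ {n} → Rule n → Loc n
fromTA (chooseTrue i)  = ℓ i
fromTA (chooseFalse i) = ℓ i
fromTA (topMid i)      = top i
fromTA (botMid i)      = bot i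
fromTA midFin          = mid
toTA (chooseTrue i)  = top i
toTA (chooseFalse i) = bot i
toTA (topMid i)      = mid
toTA (botMid i)      = mid
toTA midFin          = fin

guardTA : ∀ {n m} → Rule n → (Shared n m → ℕ) → ℕ → Set
guardTA (chooseTrue i)  g k = g (ybar i) < 1
guardTA (chooseFalse i) g k = g (y i) < 1
guardTA (topMid i)      g k = ⊤
guardTA (botMid i)      g k = ⊤
guardTA {m = m} midFin  g k = (j : Fin m) → g (c j) ≥ 1

updTA : ∀ {n m} → CNF3 n m → Rule n → Shared n m → ℕ
updTA φ (chooseTrue i)  (y j)    = if does (i ≟ᶠ j) then 1 else 0
updTA φ (chooseFalse i) (ybar j) = if does (i ≟ᶠ j) then 1 else 0
updTA φ (topMid i)      (c j)    = if occurs (pos i) (lookup φ j) then 1 else 0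
updTA φ (botMid i)      (c j)    = if occurs (neg i) (lookup φ j) then 1 else 0
updTA φ _ _ = 0

TA[_] : ∀ {n m} → CNF3 n m → ThresholdAutomaton
TA[_] {n} {m} φ = record
  { Loc = Loc n ; allLoc = allLocTA n ; Initial = InitialTA
  ; Shared = Shared n m ; Rule = Rule n
  ; from = fromTA ; to = toTA ; guard = guardTA ; upd = updTA φ
  ; locEq = locEqTA }

-- Choosing ⊤ᵢ sets yᵢ and is guarded by ȳᵢ < 1, choosing ⊥ᵢ sets ȳᵢ and is
-- guarded by yᵢ < 1, and shared variables only grow. Hence along any path
-- yᵢ = 0 or ȳᵢ = 0 at every configuration, while an occupied ⊤ᵢ (resp. ⊥ᵢ)
-- forces yᵢ ≥ 1 (resp. ȳᵢ ≥ 1) from then on. If ⊤ᵢ and ⊥ᵢ were both occupied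
-- somewhere on the path, the last configuration would have yᵢ ≥ 1 and ȳᵢ ≥ 1.
module Submission where

open import Defs
open import Data.Nat using (ℕ; _≤_; _≥_; _+_; _∸_)
open import Data.Nat.Properties
  using (≤-refl; ≤-trans; ≤-reflexive; m≤m+n; m≤n+m; m∸n≤m; +-identityʳ; ≰⇒>; n<1⇒n≡0; m<n⇒n≢0)
open import Data.Fin using (Fin)
open import Data.Fin.Properties using () renaming (_≟_ to _≟ᶠ_)
open import Data.List using (List; []; _∷_)
open import Data.Product using (_×_; ∃; _,_; proj₂)
open import Data.Sum using (_⊎_; inj₁; inj₂)
open import Data.Empty using (⊥; ⊥-elim)
open import Data.Bool using (true; false)
open import Relation.Nullary using (yes; no)
open import Relation.Nullary.Decidable using (dec-true)
open import Relation.Binary.PropositionalEquality using (_≡_; refl; cong₂; trans)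

module _ (TA : ThresholdAutomaton) where
  open ThresholdAutomaton TA using (from; to; locEq) renaming (Rule to Ruleᵀ)

  final : Config TA → List Ruleᵀ → Config TA
  final σ []      = σ
  final σ (r ∷ τ) = final (apply TA r σ) τ

  final-onPath : ∀ σ τ → OnPath TA σ τ (final σ τ)
  final-onPath σ []      = here
  final-onPath σ (r ∷ τ) = there (final-onPath (apply TA r σ) τ)

  shared-≤-final : ∀ {σ τ σ′} → OnPath TA σ τ σ′ → ∀ x → g σ′ x ≤ g (final σ τ) x
  shared-≤-final {τ = []}    here x = ≤-refl
  shared-≤-final {τ = r ∷ τ} here x = ≤-trans (m≤m+n _ _) (shared-≤-final {τ = τ} here x)
  shared-≤-final (there p)   x = shared-≤-final p x

  Inductive : (Config TA → Set) → Set
  Inductive P = ∀ {r σ} → Enabled TA r σ → P σ → P (apply TA r σ)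

  inductive-onPath : ∀ {P} → Inductive P →
                     ∀ {σ τ σ′} → P σ → Applicable TA σ τ → OnPath TA σ τ σ′ → P σ′
  inductive-onPath step Pσ _        here      = Pσ
  inductive-onPath step Pσ (e ∷ ap) (there p) = inductive-onPath step (step e Pσ) ap p

  occupied-after-apply : ∀ r σ l → κ (apply TA r σ) l ≥ 1 → κ σ l ≥ 1 ⊎ locEq l (to r) ≡ true
  occupied-after-apply r σ l h with locEq l (to r)
  ... | true  = inj₂ refl
  ... | false = inj₁ (≤-trans h (≤-trans (≤-reflexive (+-identityʳ _)) κ-decreases))
    where
    κ-decreases : κ σ l ∸ [_] TA (locEq l (from r)) ≤ κ σ l
    κ-decreases = m∸n≤m (κ σ l) ([_] TA (locEq l (from r)))

module _ {n m : ℕ} (φ : CNF3 n m) (i : Fin n) where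

  only-chooseTrue-enters-top : ∀ r → locEqTA (top i) (toTA r) ≡ true → r ≡ chooseTrue i
  only-chooseTrue-enters-top (chooseTrue j) e with i ≟ᶠ j
  ... | yes refl = refl
  only-chooseTrue-enters-top (chooseTrue j) () | no _

  only-chooseFalse-enters-bot : ∀ r → locEqTA (bot i) (toTA r) ≡ true → r ≡ chooseFalse i
  only-chooseFalse-enters-bot (chooseFalse j) e with i ≟ᶠ j
  ... | yes refl = refl
  only-chooseFalse-enters-bot (chooseFalse j) () | no _

  only-chooseTrue-updates-y : ∀ r → updTA φ r (y i) ≡ 0 ⊎ r ≡ chooseTrue i
  only-chooseTrue-updates-y (chooseTrue j) with j ≟ᶠ i
  ... | yes refl = inj₂ refl
  ... | no _     = inj₁ refl
  only-chooseTrue-updates-y (chooseFalse j) = inj₁ refl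
  only-chooseTrue-updates-y (topMid j)      = inj₁ refl
  only-chooseTrue-updates-y (botMid j)      = inj₁ refl
  only-chooseTrue-updates-y midFin          = inj₁ refl

  only-chooseFalse-updates-ȳ : ∀ r → updTA φ r (ybar i) ≡ 0 ⊎ r ≡ chooseFalse i
  only-chooseFalse-updates-ȳ (chooseFalse j) with j ≟ᶠ i
  ... | yes refl = inj₂ refl
  ... | no _     = inj₁ refl
  only-chooseFalse-updates-ȳ (chooseTrue j) = inj₁ refl
  only-chooseFalse-updates-ȳ (topMid j)     = inj₁ refl
  only-chooseFalse-updates-ȳ (botMid j)     = inj₁ refl
  only-chooseFalse-updates-ȳ midFin         = inj₁ refl

  chooseTrue-sets-y : ∀ σ → g (apply TA[ φ ] (chooseTrue i) σ) (y i) ≥ 1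
  chooseTrue-sets-y σ rewrite dec-true (i ≟ᶠ i) refl = m≤n+m 1 _

  chooseFalse-sets-ȳ : ∀ σ → g (apply TA[ φ ] (chooseFalse i) σ) (ybar i) ≥ 1
  chooseFalse-sets-ȳ σ rewrite dec-true (i ≟ᶠ i) refl = m≤n+m 1 _

  record ChoiceInvariant (σ : Config TA[ φ ]) : Set where
    field
      top⇒y    : κ σ (top i) ≥ 1 → g σ (y i) ≥ 1
      bot⇒ȳ    : κ σ (bot i) ≥ 1 → g σ (ybar i) ≥ 1
      y∨ȳ-zero : g σ (y i) ≡ 0 ⊎ g σ (ybar i) ≡ 0
  open ChoiceInvariant

  initial-choiceInvariant : ∀ {σ} → IsInitial TA[ φ ] σ → ChoiceInvariant σ
  initial-choiceInvariant (_ , κ₀ , g₀) = record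
    { top⇒y    = λ h → ⊥-elim (m<n⇒n≢0 h (κ₀ (top i) λ ()))
    ; bot⇒ȳ    = λ h → ⊥-elim (m<n⇒n≢0 h (κ₀ (bot i) λ ()))
    ; y∨ȳ-zero = inj₁ (g₀ (y i))
    }

  choiceInvariant-inductive : Inductive TA[ φ ] ChoiceInvariant
  choiceInvariant-inductive {r} {σ} en I = record
    { top⇒y = top⇒y′ ; bot⇒ȳ = bot⇒ȳ′ ; y∨ȳ-zero = y∨ȳ-zero′ (y∨ȳ-zero I) }
    where
    σ′ = apply TA[ φ ] r σ

    top⇒y′ : κ σ′ (top i) ≥ 1 → g σ′ (y i) ≥ 1
    top⇒y′ h with occupied-after-apply TA[ φ ] r σ (top i) h
    ... | inj₁ h′ = ≤-trans (top⇒y I h′) (m≤m+n _ _)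
    ... | inj₂ e with refl ← only-chooseTrue-enters-top r e = chooseTrue-sets-y σ

    bot⇒ȳ′ : κ σ′ (bot i) ≥ 1 → g σ′ (ybar i) ≥ 1
    bot⇒ȳ′ h with occupied-after-apply TA[ φ ] r σ (bot i) h
    ... | inj₁ h′ = ≤-trans (bot⇒ȳ I h′) (m≤m+n _ _)
    ... | inj₂ e with refl ← only-chooseFalse-enters-bot r e = chooseFalse-sets-ȳ σ

    -- The guard of the rule that would make the zero variable positive
    -- says that the other one is still zero.
    y∨ȳ-zero′ : g σ (y i) ≡ 0 ⊎ g σ (ybar i) ≡ 0 → g σ′ (y i) ≡ 0 ⊎ g σ′ (ybar i) ≡ 0
    y∨ȳ-zero′ (inj₁ y≡0) with only-chooseTrue-updates-y r
    ... | inj₁ u    = inj₁ (cong₂ _+_ y≡0 u)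
    ... | inj₂ refl = inj₂ (trans (+-identityʳ _) (n<1⇒n≡0 (proj₂ en)))
    y∨ȳ-zero′ (inj₂ ȳ≡0) with only-chooseFalse-updates-ȳ r
    ... | inj₁ u    = inj₂ (cong₂ _+_ ȳ≡0 u)
    ... | inj₂ refl = inj₁ (trans (+-identityʳ _) (n<1⇒n≡0 (proj₂ en)))

  top-bot-exclusive : ∀ {σ₀ τ σ σ′} → IsInitial TA[ φ ] σ₀ → Applicable TA[ φ ] σ₀ τ →
                      OnPath TA[ φ ] σ₀ τ σ → κ σ (top i) ≥ 1 →
                      OnPath TA[ φ ] σ₀ τ σ′ → κ σ′ (bot i) ≥ 1 → ⊥
  top-bot-exclusive {σ₀} {τ} ini ap p h p′ h′ =
    neither-zero (y∨ȳ-zero (invariant-at (final-onPath TA[ φ ] σ₀ τ)))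
    where
    invariant-at : ∀ {σ} → OnPath TA[ φ ] σ₀ τ σ → ChoiceInvariant σ
    invariant-at = inductive-onPath TA[ φ ] choiceInvariant-inductive (initial-choiceInvariant ini) ap

    σₑ = final TA[ φ ] σ₀ τ

    neither-zero : g σₑ (y i) ≡ 0 ⊎ g σₑ (ybar i) ≡ 0 → ⊥
    neither-zero (inj₁ y≡0) =
      m<n⇒n≢0 (≤-trans (top⇒y (invariant-at p) h) (shared-≤-final TA[ φ ] p (y i))) y≡0
    neither-zero (inj₂ ȳ≡0) =
      m<n⇒n≢0 (≤-trans (bot⇒ȳ (invariant-at p′) h′) (shared-≤-final TA[ φ ] p′ (ybar i))) ȳ≡0

lemma1 : (n m : ℕ) (φ : CNF3 n m) (σ₀ : Config TA[ φ ]) (τ : List (Rule n)) →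
         IsInitial TA[ φ ] σ₀ → Applicable TA[ φ ] σ₀ τ →
         (i : Fin n) →
         ((∃ λ σ → OnPath TA[ φ ] σ₀ τ σ × κ σ (top i) ≥ 1) →
            ∀ σ′ → OnPath TA[ φ ] σ₀ τ σ′ → κ σ′ (bot i) ≡ 0)
         × ((∃ λ σ → OnPath TA[ φ ] σ₀ τ σ × κ σ (bot i) ≥ 1) →
            ∀ σ′ → OnPath TA[ φ ] σ₀ τ σ′ → κ σ′ (top i) ≡ 0)
lemma1 n m φ σ₀ τ ini ap i =
    (λ (σ , p , h) σ′ p′ → n<1⇒n≡0 (≰⇒> λ h′ → top-bot-exclusive φ i ini ap p h p′ h′))
  , (λ (σ , p , h) σ′ p′ → n<1⇒n≡0 (≰⇒> λ h′ → top-bot-exclusive φ i ini ap p′ h′ p h))
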